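{- Let $a,b,q,r$ be non-negative integers such that $q,r\ge 2$ and $a+b\ge 1$. If the graphs $H$ and $H'$ are both $q$-equivalent and $r$-equivalent, then they are $(aq+br)$-equivalent.
   Context: All graphs are finite and simple. For an integer $m\ge 2$, a graph $G$ is $m$-Ramsey for $H$ if every colouring of $E(G)$ with $m$ colours contains a monochromatic copy of $H$; $G$ is $m$-Ramsey-minimal for $H$ if it is $m$-Ramsey for $H$ but no proper subgraph of $G$ is; $\mathcal{M}_m(H)$ is the set of all $m$-Ramsey-minimal graphs for $H$. Two graphs $H,H'$ are $m$-equivalent if $\mathcal{M}_m(H)=\mathcal{M}_m(H')$. -}

module Defs where

open import Data.Nat using (ℕ)
open import Data.Fin using (Fin)
open import Data.Bool using (Bool; true; false)
open import Data.Product using (Σ; ∃; _×_; _,_)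
open import Relation.Binary.PropositionalEquality using (_≡_)
open import Relation.Nullary using (¬_)
open import Function.Definitions using (Injective)
open import Function.Bundles using (_⇔_)

record Graph : Set where
  field
    n     : ℕ
    adj   : Fin n → Fin n → Bool
    sym   : ∀ u v → adj u v ≡ adj v u
    irref : ∀ u → adj u u ≡ false
open Graph public

-- An edge colouring of G with m colours: a colour for every (unordered)
-- pair of vertices, given as a symmetric function; only values on edges matter.
record Colouring (m : ℕ) (G : Graph) : Set where
  field
    col    : Fin (n G) → Fin (n G) → Fin m
    colSym : ∀ u v → col u v ≡ col v u
open Colouring public

MonoCopy : ∀ {m} (H G : Graph) → Colouring m G → Set
MonoCopy {m} H G c =
  Σ (Fin (n H) → Fin (n G)) λ f →
    Injective _≡_ _≡_ f ×
    ∃ λ (k : Fin m) → ∀ u v → adj H u v ≡ true →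
      (adj G (f u) (f v) ≡ true) × (col c (f u) (f v) ≡ k)

IsRamsey : ℕ → Graph → Graph → Set
IsRamsey m H G = (c : Colouring m G) → MonoCopy H G c

IsEmbedding : (G' G : Graph) → (Fin (n G') → Fin (n G)) → Set
IsEmbedding G' G φ =
  Injective _≡_ _≡_ φ × (∀ u v → adj G' u v ≡ true → adj G (φ u) (φ v) ≡ true)

IsOnto : (G' G : Graph) → (Fin (n G') → Fin (n G)) → Set
IsOnto G' G φ =
  (∀ y → ∃ λ x → φ x ≡ y) × (∀ u v → adj G (φ u) (φ v) ≡ true → adj G' u v ≡ true)

IsProperSubgraph : Graph → Graph → Set
IsProperSubgraph G' G =
  Σ (Fin (n G') → Fin (n G)) λ φ → IsEmbedding G' G φ × ¬ IsOnto G' G φ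

IsRamseyMinimal : ℕ → Graph → Graph → Set
IsRamseyMinimal m H G =
  IsRamsey m H G × (∀ G' → IsProperSubgraph G' G → ¬ IsRamsey m H G')

Equivalent : ℕ → Graph → Graph → Set
Equivalent m H H' = ∀ (G : Graph) → IsRamseyMinimal m H G ⇔ IsRamseyMinimal m H' G

-- Write H ⇒ₘ H′ (RamseyImplies m H H′) when every m-Ramsey graph for H is m-Ramsey for H′.
-- Every m-Ramsey graph contains an m-Ramsey-minimal subgraph (proper subgraphs have fewer
-- vertices plus edges) and being m-Ramsey is inherited by supergraphs, so H and H′ are
-- m-equivalent iff H ⇒ₘ H′ and H′ ⇒ₘ H. The relation ⇒ₘ is additive in m: split an
-- (s + t)-colouring of an (s + t)-Ramsey graph G for H into the spanning subgraph of edges with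
-- one of the first s colours and the one with the last t colours. If neither were Ramsey (for
-- s resp. t colours), bad colourings of the two could be merged into a bad (s + t)-colouring of
-- G; so one of them is Ramsey for H, hence for H′, which yields a monochromatic H′ in G. Thus
-- ⇒_q and ⇒_r give ⇒_(aq + br). Monochromatic copies are found by a finite search, so the
-- classical steps (excluded middle on subgraphs and colourings) go through under double negation.

module Submission where

open import Defs hiding (sym)
open import Data.Bool using (Bool; true; false; not; _∧_)
open import Data.Bool.Properties using (∧-zeroʳ; ∧-identityʳ) renaming (_≟_ to _≟ᵇ_)
open import Data.Empty using (⊥-elim)
open import Data.Fin using (Fin; zero; suc; punchIn; punchOut; combine; remQuot; splitAt; _↑ˡ_; _↑ʳ_; _≟_)
open import Data.Fin.Properties
  using (suc-injective; punchInᵢ≢i; punchIn-punchOut; punchOut-injective; any?; all?;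
         remQuot-combine; combine-remQuot; combine-injective; injective⇒≤;
         ↑ˡ-injective; ↑ʳ-injective; splitAt-↑ˡ; splitAt-↑ʳ; splitAt⁻¹-↑ˡ; splitAt⁻¹-↑ʳ)
open import Data.Nat using (ℕ; zero; suc; _+_; _*_; _≤_; _<_; _<?_; z≤n)
open import Data.Nat.Induction using (<-wellFounded)
open import Data.Nat.Properties
  using (≤-refl; +-mono-≤; +-assoc; +-comm; +-identityʳ; n<1+n; +-mono-<-≤; +-mono-≤-<; module ≤-Reasoning)
open import Data.Product using (Σ; ∃; _×_; _,_; proj₁; proj₂; uncurry; map)
open import Data.Sum using (_⊎_; inj₁; inj₂; [_,_])
open import Data.Vec.Functional using (_∷_; tail)
open import Function using (_∘_; id; const)
open import Function.Bundles using (mk⇔; Equivalence)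
import Function.Properties.Equivalence as ⇔
open import Function.Definitions using (Injective)
open import Induction.WellFounded using (Acc; acc)
open import Relation.Binary.PropositionalEquality hiding ([_])
open import Relation.Nullary using (¬_; Dec; yes; no)
open import Relation.Nullary.Decidable using (does; dec-true; dec-false; map′; _×-dec_; _→-dec_; decidable-stable; ¬¬-excluded-middle)
open import Relation.Nullary.Negation using (¬¬-map)

indicator : Bool → ℕ
indicator true  = 1
indicator false = 0

count : ∀ {n} → (Fin n → Bool) → ℕ
count {zero}  P = 0
count {suc n} P = indicator (P zero) + count (P ∘ suc)

count-true : ∀ n → count {n} (λ _ → true) ≡ n
count-true zero    = refl
count-true (suc n) = cong suc (count-true n)

count-cong : ∀ {n} {P Q : Fin n → Bool} → (∀ x → P x ≡ Q x) → count P ≡ count Q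
count-cong {zero}  P≗Q = refl
count-cong {suc n} P≗Q = cong₂ _+_ (cong indicator (P≗Q zero)) (count-cong (P≗Q ∘ suc))

count-punchIn : ∀ {n} (Q : Fin (suc n) → Bool) i →
                count Q ≡ indicator (Q i) + count (Q ∘ punchIn i)
count-punchIn Q zero = refl
count-punchIn {suc n} Q (suc i) = begin
  indicator (Q zero) + count (Q ∘ suc)
    ≡⟨ cong (indicator (Q zero) +_) (count-punchIn (Q ∘ suc) i) ⟩
  indicator (Q zero) + (indicator (Q (suc i)) + count (Q ∘ suc ∘ punchIn i))
    ≡⟨ sym (+-assoc (indicator (Q zero)) _ _) ⟩
  indicator (Q zero) + indicator (Q (suc i)) + count (Q ∘ suc ∘ punchIn i)
    ≡⟨ cong (_+ count (Q ∘ suc ∘ punchIn i)) (+-comm (indicator (Q zero)) _) ⟩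
  indicator (Q (suc i)) + indicator (Q zero) + count (Q ∘ suc ∘ punchIn i)
    ≡⟨ +-assoc (indicator (Q (suc i))) _ _ ⟩
  indicator (Q (suc i)) + count (Q ∘ punchIn (suc i))
    ∎
  where open ≡-Reasoning

indicator-mono : ∀ {x y} → (x ≡ true → y ≡ true) → indicator x ≤ indicator y
indicator-mono {false} x⇒y = z≤n
indicator-mono {true}  x⇒y rewrite x⇒y refl = ≤-refl

count-mono : ∀ {a b} {f : Fin a → Fin b} → Injective _≡_ _≡_ f →
             {P : Fin a → Bool} {Q : Fin b → Bool} →
             (∀ x → P x ≡ true → Q (f x) ≡ true) → count P ≤ count Q
count-mono {zero} f-inj PQ = z≤n
count-mono {suc a} {zero} {f} f-inj PQ with () ← f zero
count-mono {suc a} {suc b} {f} f-inj {P} {Q} PQ = begin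
  indicator (P zero) + count (P ∘ suc)
    ≤⟨ +-mono-≤ (indicator-mono (PQ zero)) (count-mono g-inj {P ∘ suc} PQ′) ⟩
  indicator (Q (f zero)) + count (Q ∘ punchIn (f zero))
    ≡⟨ sym (count-punchIn Q (f zero)) ⟩
  count Q
    ∎
  where
  open ≤-Reasoning
  f0≢f[1+x] : ∀ x → f zero ≢ f (suc x)
  f0≢f[1+x] x eq with () ← f-inj eq
  g : Fin a → Fin b
  g x = punchOut (f0≢f[1+x] x)
  g-inj : Injective _≡_ _≡_ g
  g-inj {x} {y} eq = suc-injective (f-inj (punchOut-injective (f0≢f[1+x] x) (f0≢f[1+x] y) eq))
  PQ′ : ∀ x → P (suc x) ≡ true → Q (punchIn (f zero) (g x)) ≡ true
  PQ′ x Px = subst (λ z → Q z ≡ true) (sym (punchIn-punchOut _)) (PQ (suc x) Px)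

count-strict : ∀ {a b} {f : Fin a → Fin b} → Injective _≡_ _≡_ f →
               {P : Fin a → Bool} {Q : Fin b → Bool} →
               (∀ x → P x ≡ true → Q (f x) ≡ true) →
               ∀ y → Q y ≡ true → (∀ x → P x ≡ true → f x ≢ y) → count P < count Q
count-strict {b = zero} f-inj PQ () Qy avoid
count-strict {b = suc b} {f} f-inj {P} {Q} PQ y Qy avoid = begin-strict
  count P                        ≤⟨ count-mono f-inj {P} {Q-but-y} PQ-but-y ⟩
  count Q-but-y                  ≡⟨ count-punchIn Q-but-y y ⟩
  indicator (Q-but-y y) + count (Q-but-y ∘ punchIn y)
                                 ≡⟨ cong₂ _+_ (cong indicator Q-but-y[y]) (count-cong Q-but-y∘punchIn) ⟩
  count (Q ∘ punchIn y)          <⟨ n<1+n _ ⟩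
  indicator true + count (Q ∘ punchIn y)
                                 ≡⟨ cong (λ q → indicator q + count (Q ∘ punchIn y)) Qy ⟨
  indicator (Q y) + count (Q ∘ punchIn y)
                                 ≡⟨ count-punchIn Q y ⟨
  count Q                        ∎
  where
  open ≤-Reasoning
  Q-but-y : Fin (suc b) → Bool
  Q-but-y z = Q z ∧ not (does (z ≟ y))
  PQ-but-y : ∀ x → P x ≡ true → Q-but-y (f x) ≡ true
  PQ-but-y x Px rewrite PQ x Px | dec-false (f x ≟ y) (avoid x Px) = refl
  Q-but-y[y] : Q-but-y y ≡ false
  Q-but-y[y] rewrite dec-true (y ≟ y) refl = ∧-zeroʳ (Q y)
  Q-but-y∘punchIn : ∀ x → Q-but-y (punchIn y x) ≡ Q (punchIn y x)
  Q-but-y∘punchIn x rewrite dec-false (punchIn y x ≟ y) (punchInᵢ≢i y x) = ∧-identityʳ _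

adjacentPair : (G : Graph) → Fin (n G * n G) → Bool
adjacentPair G = uncurry (adj G) ∘ remQuot {n G} (n G)

edgeCount : Graph → ℕ
edgeCount G = count (adjacentPair G)

size : Graph → ℕ
size G = n G + edgeCount G

adjacentPair-combine : ∀ G u v → adjacentPair G (combine u v) ≡ adj G u v
adjacentPair-combine G u v = cong (uncurry (adj G)) (remQuot-combine u v)

module _ {G′ G : Graph} {φ : Fin (n G′) → Fin (n G)} (φ-emb : IsEmbedding G′ G φ) where

  private
    φ-inj : Injective _≡_ _≡_ φ
    φ-inj = proj₁ φ-emb

    φ-adj : ∀ u v → adj G′ u v ≡ true → adj G (φ u) (φ v) ≡ true
    φ-adj = proj₂ φ-emb

    φ² : Fin (n G′ * n G′) → Fin (n G * n G)
    φ² = uncurry combine ∘ map φ φ ∘ remQuot {n G′} (n G′)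

    φ²-inj : Injective _≡_ _≡_ φ²
    φ²-inj {i} {j} eq with combine-injective _ _ _ _ eq
    ... | eq₁ , eq₂ = begin
      i                                          ≡⟨ combine-remQuot {n G′} (n G′) i ⟨
      uncurry combine (remQuot {n G′} (n G′) i)  ≡⟨ cong₂ combine (φ-inj eq₁) (φ-inj eq₂) ⟩
      uncurry combine (remQuot {n G′} (n G′) j)  ≡⟨ combine-remQuot {n G′} (n G′) j ⟩
      j                                          ∎
      where open ≡-Reasoning

    φ²-adj : ∀ i → adjacentPair G′ i ≡ true → adjacentPair G (φ² i) ≡ true
    φ²-adj i a = trans (adjacentPair-combine G _ _) (φ-adj _ _ a)

  edgeCount-mono : edgeCount G′ ≤ edgeCount G
  edgeCount-mono = count-mono φ²-inj φ²-adj

  vertexCount-strict : ∀ y → ¬ (∃ λ x → φ x ≡ y) → n G′ < n G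
  vertexCount-strict y y∉im = subst₂ _<_ (count-true _) (count-true _)
    (count-strict φ-inj (λ _ _ → refl) y refl λ x _ φx≡y → y∉im (x , φx≡y))

  edgeCount-strict : ∀ u v → adj G (φ u) (φ v) ≡ true → adj G′ u v ≡ false →
                     edgeCount G′ < edgeCount G
  edgeCount-strict u v a ¬a′ =
    count-strict φ²-inj φ²-adj (combine (φ u) (φ v)) (trans (adjacentPair-combine G _ _) a) avoids
    where
    avoids : ∀ i → adjacentPair G′ i ≡ true → φ² i ≢ combine (φ u) (φ v)
    avoids i a′ eq with combine-injective _ _ _ _ eq
    ... | eq₁ , eq₂ with () ← trans (sym a′) (trans (cong₂ (adj G′) (φ-inj eq₁) (φ-inj eq₂)) ¬a′)

  size-strict : ¬ IsOnto G′ G φ → size G′ < size G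
  size-strict not-onto with size G′ <? size G
  ... | yes lt = lt
  ... | no ¬lt = ⊥-elim (not-onto (surjective , reflects))
    where
    surjective : ∀ y → ∃ λ x → φ x ≡ y
    surjective y with any? (λ x → φ x ≟ y)
    ... | yes y∈im = y∈im
    ... | no y∉im = ⊥-elim (¬lt (+-mono-<-≤ (vertexCount-strict y y∉im) edgeCount-mono))
    reflects : ∀ u v → adj G (φ u) (φ v) ≡ true → adj G′ u v ≡ true
    reflects u v a with adj G′ u v in eq
    ... | true  = refl
    ... | false = ⊥-elim (¬lt (+-mono-≤-< (injective⇒≤ φ-inj) (edgeCount-strict u v a eq)))

any-function? : ∀ {a b} {P : (Fin a → Fin b) → Set} →
                (∀ {f g} → (∀ x → f x ≡ g x) → P f → P g) →
                (∀ f → Dec (P f)) → Dec (∃ P)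
any-function? {zero} resp P? =
  map′ (λ p → _ , p) (λ (f , p) → resp (λ ()) p) (P? (λ ()))
any-function? {suc a} resp P? =
  map′ (λ (y , g , p) → y ∷ g , p) (λ (f , p) → f zero , tail f , resp cons-tail p)
       (any? λ y → any-function? (resp ∘ ∷-cong y) (P? ∘ (y ∷_)))
  where
  ∷-cong : ∀ y {g g′} → (∀ x → g x ≡ g′ x) → ∀ x → (y ∷ g) x ≡ (y ∷ g′) x
  ∷-cong y g≗g′ zero    = refl
  ∷-cong y g≗g′ (suc x) = g≗g′ x
  cons-tail : ∀ {f : Fin (suc a) → Fin _} x → f x ≡ (f zero ∷ tail f) x
  cons-tail zero    = refl
  cons-tail (suc x) = refl

IsMonoCopy : ∀ {m} H G → Colouring m G → (Fin (n H) → Fin (n G)) → Set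
IsMonoCopy {m} H G c f =
  Injective _≡_ _≡_ f ×
  ∃ λ (k : Fin m) → ∀ u v → adj H u v ≡ true → (adj G (f u) (f v) ≡ true) × (col c (f u) (f v) ≡ k)

isMonoCopy-resp : ∀ {m} H G (c : Colouring m G) {f g} → (∀ x → f x ≡ g x) →
                  IsMonoCopy H G c f → IsMonoCopy H G c g
isMonoCopy-resp H G c f≗g (f-inj , k , mono) =
  (λ {x} {y} eq → f-inj (trans (f≗g x) (trans eq (sym (f≗g y))))) ,
  k , λ u v a → subst₂ (λ x y → adj G x y ≡ true × col c x y ≡ _) (f≗g u) (f≗g v) (mono u v a)

isMonoCopy? : ∀ {m} H G (c : Colouring m G) f → Dec (IsMonoCopy H G c f)
isMonoCopy? H G c f =
  map′ (λ inj {x} {y} → inj x y) (λ inj x y → inj {x} {y})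
       (all? λ x → all? λ y → (f x ≟ f y) →-dec (x ≟ y))
  ×-dec any? λ k → all? λ u → all? λ v →
    (adj H u v ≟ᵇ true) →-dec ((adj G (f u) (f v) ≟ᵇ true) ×-dec (col c (f u) (f v) ≟ k))

monoCopy? : ∀ {m} H G (c : Colouring m G) → Dec (MonoCopy H G c)
monoCopy? H G c = any-function? (isMonoCopy-resp H G c) (isMonoCopy? H G c)

monoCopy-stable : ∀ {m} H G (c : Colouring m G) → ¬ ¬ MonoCopy H G c → MonoCopy H G c
monoCopy-stable H G c = decidable-stable (monoCopy? H G c)

¬isRamsey⇒¬¬badColouring : ∀ {m} H G → ¬ IsRamsey m H G →
                           ¬ ¬ (Σ (Colouring m G) λ c → ¬ MonoCopy H G c)
¬isRamsey⇒¬¬badColouring H G ¬ramsey ¬bad =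
  ¬ramsey λ c → monoCopy-stable H G c λ ¬copy → ¬bad (c , ¬copy)

embedding-refl : ∀ {G} → IsEmbedding G G id
embedding-refl = id , λ _ _ a → a

embedding-∘ : ∀ {G₁ G₂ G₃ φ ψ} → IsEmbedding G₂ G₃ ψ → IsEmbedding G₁ G₂ φ →
              IsEmbedding G₁ G₃ (ψ ∘ φ)
embedding-∘ (ψ-inj , ψ-adj) (φ-inj , φ-adj) = φ-inj ∘ ψ-inj , λ u v → ψ-adj _ _ ∘ φ-adj u v

isRamsey-embedding : ∀ {m H G′ G φ} → IsEmbedding G′ G φ → IsRamsey m H G′ → IsRamsey m H G
isRamsey-embedding {φ = φ} (φ-inj , φ-adj) ramsey c
  with f , f-inj , k , mono ← ramsey record { col = λ u v → col c (φ u) (φ v)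
                                            ; colSym = λ u v → colSym c (φ u) (φ v) }
  = φ ∘ f , f-inj ∘ φ-inj , k , λ u v a → φ-adj _ _ (proj₁ (mono u v a)) , proj₂ (mono u v a)

MinimalRamseySubgraph : ℕ → Graph → Graph → Set
MinimalRamseySubgraph m H G =
  Σ Graph λ G″ → (∃ λ ψ → IsEmbedding G″ G ψ) × IsRamseyMinimal m H G″

ProperRamseySubgraph : ℕ → Graph → Graph → Set
ProperRamseySubgraph m H G = Σ Graph λ G′ → IsProperSubgraph G′ G × IsRamsey m H G′

¬¬minimalRamseySubgraph : ∀ {m H G} → IsRamsey m H G → ¬ ¬ MinimalRamseySubgraph m H G
¬¬minimalRamseySubgraph {m} {H} {G} = descend {m} {H} {G} (<-wellFounded (size G))
  where
  descend : ∀ {m H G} → Acc _<_ (size G) → IsRamsey m H G → ¬ ¬ MinimalRamseySubgraph m H G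
  descend {m} {H} {G} (acc smaller) ramsey ¬minimal =
    ¬¬-excluded-middle {A = ProperRamseySubgraph m H G} λ where
      (yes (G′ , (φ , φ-emb , not-onto) , ramsey′)) →
        descend {m} {H} {G′} (smaller (size-strict {G′} {G} φ-emb not-onto)) ramsey′
          λ (G″ , (ψ , ψ-emb) , minimal) →
            ¬minimal (G″ , (φ ∘ ψ , embedding-∘ {G″} {G′} {G} φ-emb ψ-emb) , minimal)
      (no ¬proper) →
        ¬minimal (G , (id , embedding-refl {G}) , ramsey ,
                  λ G′ proper ramsey′ → ¬proper (G′ , proper , ramsey′))

∧-intro : ∀ {x y} → x ≡ true → y ≡ true → x ∧ y ≡ true
∧-intro refl refl = refl

∧-elim : ∀ {x y} → x ∧ y ≡ true → x ≡ true × y ≡ true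
∧-elim {true} y≡true = refl , y≡true

restrict : ∀ {m} (G : Graph) → Colouring m G → (Fin m → Bool) → Graph
restrict G c P = record
  { n     = n G
  ; adj   = λ u v → adj G u v ∧ P (col c u v)
  ; sym   = λ u v → cong₂ _∧_ (Graph.sym G u v) (cong P (colSym c u v))
  ; irref = λ u → cong (_∧ P (col c u u)) (irref G u)
  }

recolour : ∀ {m k G} (c : Colouring m G) P → (Fin m → Fin k) → Colouring k (restrict G c P)
recolour c P g = record { col = λ u v → g (col c u v) ; colSym = λ u v → cong g (colSym c u v) }

monoCopy-restrict : ∀ {m k} H {G} (c : Colouring m G) {P} (g : Fin m → Fin k) (e : Fin k → Fin m) →
                    (∀ z j → P z ≡ true → g z ≡ j → z ≡ e j) →
                    MonoCopy H (restrict G c P) (recolour c P g) → MonoCopy H G c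
monoCopy-restrict H c g e recover (f , f-inj , j , mono) = f , f-inj , e j , λ u v a →
  let (a′ , Pz) = ∧-elim (proj₁ (mono u v a)) in a′ , recover _ _ Pz (proj₂ (mono u v a))

module ColourSplit (s t : ℕ) where

  isLeft isRight : Fin (s + t) → Bool
  isLeft  = [ const true  , const false ] ∘ splitAt s
  isRight = [ const false , const true  ] ∘ splitAt s

  -- The defaults i₀, j₀ are junk colours, never read on the edges of Left resp. Right.
  leftPart : Fin s → Fin (s + t) → Fin s
  leftPart i₀ = [ id , const i₀ ] ∘ splitAt s

  rightPart : Fin t → Fin (s + t) → Fin t
  rightPart j₀ = [ const j₀ , id ] ∘ splitAt s

  leftPart-recover : ∀ i₀ z i → isLeft z ≡ true → leftPart i₀ z ≡ i → z ≡ i ↑ˡ t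
  leftPart-recover i₀ z i with splitAt s z in eq
  ... | inj₁ _ = λ _ eq′ → trans (sym (splitAt⁻¹-↑ˡ eq)) (cong (_↑ˡ t) eq′)
  ... | inj₂ _ = λ ()

  rightPart-recover : ∀ j₀ z j → isRight z ≡ true → rightPart j₀ z ≡ j → z ≡ s ↑ʳ j
  rightPart-recover j₀ z j with splitAt s z in eq
  ... | inj₁ _ = λ ()
  ... | inj₂ _ = λ _ eq′ → trans (sym (splitAt⁻¹-↑ʳ eq)) (cong (s ↑ʳ_) eq′)

  ↑ʳ≢↑ˡ : ∀ {i : Fin s} {j : Fin t} → s ↑ʳ j ≢ i ↑ˡ t
  ↑ʳ≢↑ˡ {i} {j} eq
    with () ← trans (sym (splitAt-↑ʳ s t j)) (trans (cong (splitAt s) eq) (splitAt-↑ˡ s i t))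

  choose : Fin (s + t) → Fin s → Fin t → Fin (s + t)
  choose z i j = [ const (i ↑ˡ t) , const (s ↑ʳ j) ] (splitAt s z)

  choose-↑ˡ : ∀ z i j i′ → choose z i j ≡ i′ ↑ˡ t → isLeft z ≡ true × i ≡ i′
  choose-↑ˡ z i j i′ with splitAt s z
  ... | inj₁ _ = λ eq → refl , ↑ˡ-injective t i i′ eq
  ... | inj₂ _ = ⊥-elim ∘ ↑ʳ≢↑ˡ

  choose-↑ʳ : ∀ z i j j′ → choose z i j ≡ s ↑ʳ j′ → isRight z ≡ true × j ≡ j′
  choose-↑ʳ z i j j′ with splitAt s z
  ... | inj₁ _ = ⊥-elim ∘ ↑ʳ≢↑ˡ ∘ sym
  ... | inj₂ _ = λ eq → refl , ↑ʳ-injective s j j′ eq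

  module _ {G : Graph} (c : Colouring (s + t) G) where

    Left Right : Graph
    Left  = restrict G c isLeft
    Right = restrict G c isRight

    merge : Colouring s Left → Colouring t Right → Colouring (s + t) G
    merge d₁ d₂ = record
      { col    = λ u v → choose (col c u v) (col d₁ u v) (col d₂ u v)
      ; colSym = merge-sym
      }
      where
      merge-sym : ∀ u v → choose (col c u v) (col d₁ u v) (col d₂ u v)
                        ≡ choose (col c v u) (col d₁ v u) (col d₂ v u)
      merge-sym u v rewrite colSym c u v | colSym d₁ u v | colSym d₂ u v = refl

    monoCopy-merge : ∀ H d₁ d₂ → MonoCopy H G (merge d₁ d₂) →
                     MonoCopy H Left d₁ ⊎ MonoCopy H Right d₂
    monoCopy-merge H d₁ d₂ (f , f-inj , k , mono) with splitAt s k in eq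
    ... | inj₁ i = inj₁ (f , f-inj , i , λ u v a →
            let (a′ , ck) = mono u v a
                (left , d≡i) = choose-↑ˡ _ _ _ i (trans ck (sym (splitAt⁻¹-↑ˡ eq)))
            in ∧-intro a′ left , d≡i)
    ... | inj₂ j = inj₂ (f , f-inj , j , λ u v a →
            let (a′ , ck) = mono u v a
                (right , d≡j) = choose-↑ʳ _ _ _ j (trans ck (sym (splitAt⁻¹-↑ʳ eq)))
            in ∧-intro a′ right , d≡j)

    isRamsey-split : ∀ H → IsRamsey (s + t) H G → ¬ ¬ (IsRamsey s H Left ⊎ IsRamsey t H Right)
    isRamsey-split H ramsey ¬either =
      ¬isRamsey⇒¬¬badColouring H Left (¬either ∘ inj₁) λ (d₁ , bad₁) →
      ¬isRamsey⇒¬¬badColouring H Right (¬either ∘ inj₂) λ (d₂ , bad₂) →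
      [ bad₁ , bad₂ ] (monoCopy-merge H d₁ d₂ (ramsey (merge d₁ d₂)))


RamseyImplies : ℕ → Graph → Graph → Set
RamseyImplies m H H′ = ∀ G → IsRamsey m H G → IsRamsey m H′ G

module _ (H H′ : Graph) where

  equivalent⇒ramseyImplies : ∀ {m} → Equivalent m H H′ → RamseyImplies m H H′
  equivalent⇒ramseyImplies {m} equiv G ramsey c = monoCopy-stable H′ G c
    (¬¬-map (λ (G″ , (ψ , ψ-emb) , minimal) →
               isRamsey-embedding {H = H′} {G″} {G} ψ-emb (proj₁ (Equivalence.to (equiv G″) minimal)) c)
            (¬¬minimalRamseySubgraph {m} {H} ramsey))

  ramseyImplies⇒equivalent : ∀ {m} → RamseyImplies m H H′ → RamseyImplies m H′ H → Equivalent m H H′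
  ramseyImplies⇒equivalent H⇒H′ H′⇒H G = mk⇔
    (λ (ramsey , minimal) → H⇒H′ G ramsey , λ G′ proper → minimal G′ proper ∘ H′⇒H G′)
    (λ (ramsey , minimal) → H′⇒H G ramsey , λ G′ proper → minimal G′ proper ∘ H⇒H′ G′)

  equivalent-sym : ∀ {m} → Equivalent m H H′ → Equivalent m H′ H
  equivalent-sym equiv G = ⇔.sym (equiv G)

  ramseyImplies-0 : RamseyImplies 0 H H′
  ramseyImplies-0 G ramsey c with () ← proj₁ (proj₂ (proj₂ (ramsey c)))

  ramseyImplies-+-nonzero : ∀ s t → Fin s → Fin t → RamseyImplies s H H′ → RamseyImplies t H H′ →
                            RamseyImplies (s + t) H H′
  ramseyImplies-+-nonzero s t i₀ j₀ H⇒H′ₛ H⇒H′ₜ G ramsey c =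
    monoCopy-stable H′ G c (¬¬-map [ viaLeft , viaRight ] (isRamsey-split c H ramsey))
    where
    open ColourSplit s t
    viaLeft : IsRamsey s H (Left c) → MonoCopy H′ G c
    viaLeft ramseyₗ = monoCopy-restrict H′ c (leftPart i₀) (_↑ˡ t) (leftPart-recover i₀)
      (H⇒H′ₛ (Left c) ramseyₗ (recolour c isLeft (leftPart i₀)))
    viaRight : IsRamsey t H (Right c) → MonoCopy H′ G c
    viaRight ramseyᵣ = monoCopy-restrict H′ c (rightPart j₀) (s ↑ʳ_) (rightPart-recover j₀)
      (H⇒H′ₜ (Right c) ramseyᵣ (recolour c isRight (rightPart j₀)))

  ramseyImplies-+ : ∀ s t → RamseyImplies s H H′ → RamseyImplies t H H′ → RamseyImplies (s + t) H H′
  ramseyImplies-+ zero    t       _     H⇒H′ₜ = H⇒H′ₜ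
  ramseyImplies-+ (suc s) zero    H⇒H′ₛ _     =
    subst (λ m → RamseyImplies m H H′) (sym (+-identityʳ (suc s))) H⇒H′ₛ
  ramseyImplies-+ (suc s) (suc t) = ramseyImplies-+-nonzero (suc s) (suc t) zero zero

  ramseyImplies-* : ∀ a q → RamseyImplies q H H′ → RamseyImplies (a * q) H H′
  ramseyImplies-* zero    q H⇒H′ = ramseyImplies-0
  ramseyImplies-* (suc a) q H⇒H′ = ramseyImplies-+ q (a * q) H⇒H′ (ramseyImplies-* a q H⇒H′)

  ramseyImplies-linear : ∀ a b q r → RamseyImplies q H H′ → RamseyImplies r H H′ →
                         RamseyImplies (a * q + b * r) H H′
  ramseyImplies-linear a b q r H⇒H′q H⇒H′r =
    ramseyImplies-+ (a * q) (b * r) (ramseyImplies-* a q H⇒H′q) (ramseyImplies-* b r H⇒H′r)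

mainTheorem5 : (a b q r : ℕ) → 2 ≤ q → 2 ≤ r → 1 ≤ a + b →
    (H H' : Graph) → Equivalent q H H' → Equivalent r H H' →
    Equivalent (a * q + b * r) H H'
mainTheorem5 a b q r _ _ _ H H' equiv-q equiv-r =
  ramseyImplies⇒equivalent H H'
    (ramseyImplies-linear H H' a b q r (equivalent⇒ramseyImplies H H' equiv-q)
                                       (equivalent⇒ramseyImplies H H' equiv-r))
    (ramseyImplies-linear H' H a b q r (equivalent⇒ramseyImplies H' H (equivalent-sym H H' equiv-q))
                                       (equivalent⇒ramseyImplies H' H (equivalent-sym H H' equiv-r)))
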